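{- In the setting described in the context, suppose the graph $G$ (before any application of the forcing rule) has a connected $\eta$-treedepth deletion set of size at most $k$, and let $S$ be a minimum-size connected $\eta$-treedepth deletion set of $G$. Then the forcing rule is applied at most $|S|/d$ times.
   Context: Treedepth ${\sf td}$ is defined recursively: $1$ for a single vertex; $1+\min_v {\sf td}(G-v)$ for a connected graph with more than one vertex; the maximum over components otherwise. An $\eta$-treedepth deletion set of $G$ is $S\subseteq V(G)$ with ${\sf td}(G-S)\le\eta$; it is a connected $\eta$-treedepth deletion set if moreover $G[S]$ is connected. Fix an integer $\eta\ge1$, a real $0<\varepsilon\le1$, $\delta=\varepsilon/10$ and $d=\lceil 2^{\eta+3}\eta/\delta\rceil$. Let $G$ be a graph, $k$ an integer, and $V(G)=X\uplus Z\uplus R$ a partition such that $X$ is an $\eta$-treedepth deletion set of $G$ with $|X|=\mathcal{O}(k)$, $|Z|=\mathcal{O}(k^3)$, every connected component $C$ of $G[R]$ satisfies $|N_G(C)\cap Z|\le\eta$, and for every connected component $C$ of $G[R]$ and every $\eta$-treedepth deletion set $S'$ of $G$ with $|S'|\le k$ we have $|(N_G(C)\cap X)\setminus S'|\le\eta$. Initialize $H:=\emptyset$. The forcing rule is: if some connected component $C$ of $G[R]$ satisfies $|(N_G(C)\cap X)\setminus H|>d+\eta$, then for every $u\in N_G(C)\cap X$ add to $G$ a new clique $J$ on $\eta+1$ vertices consisting of $u$ and $\eta$ new vertices, where the new vertices are adjacent only to each other and to $u$; then add all vertices of $N_G(C)$ to $H$. The rule is applied exhaustively (the set $R$ and the components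 of $G[R]$ are unchanged by adding the new vertices). -}

module Defs where

open import Data.Nat using (ℕ; zero; suc; _+_; _*_; _^_; _≤_; _<_)
open import Data.Bool using (Bool; true; false; T; not; _∧_; _∨_)
open import Data.Fin using (Fin)
open import Data.Fin.Subset using (Subset; _∈_; _∉_; _⊆_; _∩_; _∪_; _─_; _-_; ∁; ⊥; ∣_∣)
open import Data.Vec using (Vec; tabulate; lookup; []; _∷_)
open import Data.List using (List; []; _∷_; length)
open import Data.Product using (Σ; _×_; _,_; ∃)
open import Relation.Nullary using (¬_)
open import Relation.Binary.PropositionalEquality using (_≡_)
open import Function.Bundles using (_⇔_)

record Graph (n : ℕ) : Set where
  field
    adj    : Fin n → Fin n → Bool
    sym    : ∀ x y → adj x y ≡ adj y x
    irrefl : ∀ x → adj x x ≡ false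
open Graph public

module _ {n : ℕ} (G : Graph n) where

  Edge : Fin n → Fin n → Set
  Edge x y = T (adj G x y)

  data Reach (U : Subset n) : Fin n → Fin n → Set where
    here : ∀ {x} → x ∈ U → Reach U x x
    step : ∀ {x y z} → x ∈ U → Edge x y → Reach U y z → Reach U x z

  -- G[U] is connected (the empty vertex set counts as connected).
  Connected : Subset n → Set
  Connected U = ∀ x y → x ∈ U → y ∈ U → Reach U x y

  IsComponent : Subset n → Subset n → Set
  IsComponent U C = Σ (Fin n) λ x → x ∈ U × (∀ y → (y ∈ C) ⇔ Reach U x y)

  -- TdLe U h : the treedepth of G[U] is at most h, following the recursive
  -- definition: td(empty graph) = 0; td of a connected graph = 1 + min_v td(G - v);
  -- td of a disconnected graph = max over its components.
  data TdLe : Subset n → ℕ → Set where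
    empty : ∀ {U h} → (∀ x → x ∉ U) → TdLe U h
    conn  : ∀ {U h} v → v ∈ U → Connected U → TdLe (U - v) h → TdLe U (suc h)
    comps : ∀ {U h} → ¬ Connected U →
            (∀ C → IsComponent U C → TdLe C h) → TdLe U h

  TdDeletionSet : ℕ → Subset n → Set
  TdDeletionSet η S = TdLe (∁ S) η

  ConnTdDeletionSet : ℕ → Subset n → Set
  ConnTdDeletionSet η S = TdDeletionSet η S × Connected S

  MinConnTdDeletionSet : ℕ → Subset n → Set
  MinConnTdDeletionSet η S =
    ConnTdDeletionSet η S × (∀ S' → ConnTdDeletionSet η S' → ∣ S ∣ ≤ ∣ S' ∣)

  anyFin : ∀ {m} → (Fin m → Bool) → Bool
  anyFin {zero}  f = false
  anyFin {suc m} f = f Fin.zero ∨ anyFin (λ i → f (Fin.suc i))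

  Nbh : Subset n → Subset n
  Nbh C = tabulate λ y → not (lookup C y) ∧ anyFin (λ x → lookup C x ∧ adj G x y)

  -- A (partial) run of the forcing rule, starting from the marked set H,
  -- applied successively to the listed components C₁, C₂, … of G[R].
  -- The attached gadget vertices never touch R, so they do not change
  -- N_G(C) for any component C of G[R]; hence a run is determined by the
  -- chosen components and the evolution of H.
  data ForcingRun (X R : Subset n) (d η : ℕ) : Subset n → List (Subset n) → Set where
    done  : ∀ {H} → ForcingRun X R d η H []
    apply : ∀ {H C Cs} → IsComponent R C →
            d + η < ∣ (Nbh C ∩ X) ─ H ∣ →
            ForcingRun X R d η (H ∪ Nbh C) Cs →
            ForcingRun X R d η H (C ∷ Cs)

{-# OPTIONS --safe #-}
-- By minimality ∣ S ∣ ≤ k, so for every component C at most η vertices of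
-- N(C) ∩ X avoid S.  An application of the forcing rule to C sees more than d + η
-- unmarked vertices of N(C) ∩ X, hence at least d unmarked vertices of S, and marks
-- them all: the number ∣ S ─ H ∣ of unmarked vertices of S drops by d each time.
module Submission where

open import Defs hiding (sym)
open import Data.Nat using (ℕ; _+_; _*_; _^_; _≤_; _<_; suc; z≤n)
open import Data.Nat.Properties
  using (≤-trans; ≤-reflexive; <⇒≤; <-≤-trans; +-suc; +-mono-≤; +-monoˡ-≤; +-monoʳ-≤;
         +-cancelʳ-<; module ≤-Reasoning)
open import Data.Fin using (Fin)
open import Data.Fin.Subset
  using (Subset; _∈_; _∉_; _⊆_; _∩_; _∪_; _─_; ⊥; ⊤; ∣_∣; Empty; inside; outside)
open import Data.Fin.Subset.Properties
  using (p─⊥≡p; p─q─r≡p─q∪r; p─q─r≡p─r─q; ∣p─q∣≤∣p∣; p⊆q⇒∣p∣≤∣q∣; p─q⊆p;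
         x∈p∧x∉q⇒x∈p─q; x∈p∩q⁺; x∈p∩q⁻; p∩q⊆p)
open import Data.Vec using ([]; _∷_; here; there)
open import Data.List using (List; length; _∷_)
open import Data.Product using (Σ; _×_; _,_)
open import Relation.Binary.PropositionalEquality using (_≡_; refl; cong; subst; sym; trans)

private
  variable
    n : ℕ
    x : Fin n

∣p∣≡∣p∩q∣+∣p─q∣ : ∀ (p q : Subset n) → ∣ p ∣ ≡ ∣ p ∩ q ∣ + ∣ p ─ q ∣
∣p∣≡∣p∩q∣+∣p─q∣ []            []            = refl
∣p∣≡∣p∩q∣+∣p─q∣ (outside ∷ p) (inside  ∷ q) = ∣p∣≡∣p∩q∣+∣p─q∣ p q
∣p∣≡∣p∩q∣+∣p─q∣ (outside ∷ p) (outside ∷ q) = ∣p∣≡∣p∩q∣+∣p─q∣ p q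
∣p∣≡∣p∩q∣+∣p─q∣ (inside  ∷ p) (inside  ∷ q) = cong suc (∣p∣≡∣p∩q∣+∣p─q∣ p q)
∣p∣≡∣p∩q∣+∣p─q∣ (inside  ∷ p) (outside ∷ q) =
  trans (cong suc (∣p∣≡∣p∩q∣+∣p─q∣ p q)) (sym (+-suc ∣ p ∩ q ∣ ∣ p ─ q ∣))

x∈p─q⇒x∉q : ∀ {p q : Subset n} → x ∈ p ─ q → x ∉ q
x∈p─q⇒x∉q {p = _ ∷ p} {outside ∷ q} (there x∈p─q) (there x∈q) = x∈p─q⇒x∉q x∈p─q x∈q
x∈p─q⇒x∉q {p = _ ∷ p} {inside  ∷ q} (there x∈p─q) (there x∈q) = x∈p─q⇒x∉q x∈p─q x∈q

∣p─q─r∣≤∣p─r∣ : ∀ (p q r : Subset n) → ∣ p ─ q ─ r ∣ ≤ ∣ p ─ r ∣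
∣p─q─r∣≤∣p─r∣ p q r rewrite p─q─r≡p─r─q p q r = ∣p─q∣≤∣p∣ (p ─ r) q

p─q∩r⊆r─q∩p : ∀ (p q r : Subset n) → (p ─ q) ∩ r ⊆ (r ─ q) ∩ p
p─q∩r⊆r─q∩p p q r x∈ with x∈p∩q⁻ (p ─ q) r x∈
... | x∈p─q , x∈r =
  x∈p∩q⁺ (x∈p∧x∉q⇒x∈p─q x∈r (x∈p─q⇒x∉q x∈p─q) , p─q⊆p p q x∈p─q)

∩-monoʳ-⊆ : ∀ (p : Subset n) {q r} → q ⊆ r → p ∩ q ⊆ p ∩ r
∩-monoʳ-⊆ p {q} q⊆r x∈ with x∈p∩q⁻ p q x∈
... | x∈p , x∈q = x∈p∩q⁺ (x∈p , q⊆r x∈q)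

-- N plays N(C) and H the marked set.
forcing-step-marks-d-of-S : ∀ (d η : ℕ) (N X H S : Subset n) →
  d + η < ∣ (N ∩ X) ─ H ∣ → ∣ (N ∩ X) ─ S ∣ ≤ η →
  d + ∣ S ─ (H ∪ N) ∣ ≤ ∣ S ─ H ∣
forcing-step-marks-d-of-S d η N X H S many few = begin
  d + ∣ S ─ (H ∪ N) ∣
    ≤⟨ +-mono-≤ d≤∣A∩S∣ (≤-reflexive (cong ∣_∣ (sym (p─q─r≡p─q∪r S H N)))) ⟩
  ∣ A ∩ S ∣ + ∣ S ─ H ─ N ∣
    ≤⟨ +-monoˡ-≤ _ (p⊆q⇒∣p∣≤∣q∣ (p─q∩r⊆r─q∩p (N ∩ X) H S)) ⟩
  ∣ (S ─ H) ∩ (N ∩ X) ∣ + ∣ S ─ H ─ N ∣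
    ≤⟨ +-monoˡ-≤ _ (p⊆q⇒∣p∣≤∣q∣ (∩-monoʳ-⊆ (S ─ H) (p∩q⊆p N X))) ⟩
  ∣ (S ─ H) ∩ N ∣ + ∣ S ─ H ─ N ∣
    ≡⟨ sym (∣p∣≡∣p∩q∣+∣p─q∣ (S ─ H) N) ⟩
  ∣ S ─ H ∣ ∎
  where
  open ≤-Reasoning
  A = (N ∩ X) ─ H
  d≤∣A∩S∣ : d ≤ ∣ A ∩ S ∣
  d≤∣A∩S∣ = <⇒≤ (+-cancelʳ-< η d ∣ A ∩ S ∣ (<-≤-trans many (begin
    ∣ A ∣                   ≡⟨ ∣p∣≡∣p∩q∣+∣p─q∣ A S ⟩
    ∣ A ∩ S ∣ + ∣ A ─ S ∣     ≤⟨ +-monoʳ-≤ ∣ A ∩ S ∣ (≤-trans (∣p─q─r∣≤∣p─r∣ (N ∩ X) H S) few) ⟩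
    ∣ A ∩ S ∣ + η           ∎)))

module _ {n : ℕ} (G : Graph n) (X R S : Subset n) (d η : ℕ)
  (few-outside : ∀ C → IsComponent G R C → ∣ (Nbh G C ∩ X) ─ S ∣ ≤ η) where

  forcing-run-length : ∀ {H Cs} → ForcingRun G X R d η H Cs → length Cs * d ≤ ∣ S ─ H ∣
  forcing-run-length done = z≤n
  forcing-run-length {H} (apply {C = C} comp many run) =
    ≤-trans (+-monoʳ-≤ d (forcing-run-length run))
            (forcing-step-marks-d-of-S d η (Nbh G C) X H S many (few-outside C comp))

lemma2 : ∀ (η d : ℕ) → 1 ≤ η → 10 * 2 ^ (η + 3) * η ≤ d →
    ∀ {n} (G : Graph n) (k cX cZ : ℕ) (X Z R : Subset n) →
    Empty (X ∩ Z) → Empty (X ∩ R) → Empty (Z ∩ R) → X ∪ Z ∪ R ≡ ⊤ →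
    TdDeletionSet G η X → ∣ X ∣ ≤ cX * k → ∣ Z ∣ ≤ cZ * (k ^ 3) →
    (∀ C → IsComponent G R C → ∣ Nbh G C ∩ Z ∣ ≤ η) →
    (∀ C S' → IsComponent G R C → TdDeletionSet G η S' → ∣ S' ∣ ≤ k →
      ∣ (Nbh G C ∩ X) ─ S' ∣ ≤ η) →
    Σ (Subset n) (λ S₀ → ConnTdDeletionSet G η S₀ × ∣ S₀ ∣ ≤ k) →
    ∀ (S : Subset n) → MinConnTdDeletionSet G η S →
    ∀ (Cs : List (Subset n)) → ForcingRun G X R d η ⊥ Cs →
    length Cs * d ≤ ∣ S ∣
lemma2 η d _ _ G k _ _ X _ R _ _ _ _ _ _ _ _ few-outside (S₀ , S₀-conn , ∣S₀∣≤k)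
       S ((S-td , _) , S-min) Cs run =
  subst (length Cs * d ≤_) (cong ∣_∣ (p─⊥≡p S))
    (forcing-run-length G X R S d η
      (λ C comp → few-outside C S comp S-td ∣S∣≤k) run)
  where
  ∣S∣≤k : ∣ S ∣ ≤ k
  ∣S∣≤k = ≤-trans (S-min S₀ S₀-conn) ∣S₀∣≤k
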